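{- Let $r\leq 1$ be an integer coprime with $3$, and let $p>3$ be a prime such that $p\equiv -r\pmod 3$ and $p\geq 3-r$. Then $$ \sum_{k=0}^{1-r}\frac{(r-1)_k(\frac r3)_k^3}{(1)_k(\frac{2r}3)_k^3}\left(\sum_{j=0}^{k-1}\frac{1}{\frac{2r}3+j}-\sum_{j=0}^{k-1}\frac{1}{\frac{r}3+j}\right)=\sum_{k=0}^{1-r}\frac{(r-1)_k(\frac r3)_k^3}{(1)_k(\frac{2r}3)_k^3}\sum_{j=0}^{ -r}\frac{1}{\frac{2r}3+j}. $$
   Context: $(x)_n=x(x+1)\cdots(x+n-1)$ is the Pochhammer symbol (with $(x)_0=1$); this is an identity of rational numbers. -}

module Defs where

open import Data.Nat using (ℕ; zero; suc)
open import Data.Integer using (ℤ; +_; -[1+_])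
open import Data.Rational using (ℚ; mkℚ; 0ℚ; 1ℚ; _+_; _*_; _-_; 1/_)
import Data.Rational as Q

poch : ℚ → ℕ → ℚ
poch x zero    = 1ℚ
poch x (suc n) = poch x n * (x + (+ n Q./ 1))

sumRange : ℕ → (ℕ → ℚ) → ℚ
sumRange zero    f = 0ℚ
sumRange (suc n) f = sumRange n f + f n

-- multiplicative inverse, with the (unused) convention inv 0 = 0;
-- all denominators in the statement are nonzero since 3 ∤ r
inv : ℚ → ℚ
inv (mkℚ (+ zero) d c) = 0ℚ
inv q@(mkℚ (+ suc n) d c) = 1/ q
inv q@(mkℚ -[1+ n ] d c) = 1/ q

-- Put n = 1 - r ≥ 0; then c = -n, and both pairs (x , y) = (c , 1) and (a , b) are
-- reflected: x + y + n = 1. For such a pair (x)_n = (-1)^k (x)_(n-k) (y)_k, because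
-- the last k factors x + n - 1 - i of (x)_n are -(y + i); as the summand has four
-- such pairs, the signs cancel and the k-th and (n-k)-th summands coincide.
-- Reversing the range of H_b(n) = Σ_{j<n} 1/(b+j) likewise gives
-- H_b(n) = H_b(n-k) - H_a(k) and H_a(n) = H_a(n-k) - H_b(k), so the bracket
-- D_k = H_b(k) - H_a(k) satisfies D_k + D_(n-k) = H_b(n) - H_a(n) = 2 H_b(n).
-- Averaging the sum with its reversal therefore replaces D_k by H_b(n).
module Submission where

open import Defs
open import Data.Nat using (ℕ; _>_)
import Data.Nat as ℕ
open import Data.Nat.Primality using (Prime)
open import Data.Nat.Coprimality using (Coprime)
open import Data.Integer using (ℤ; +_; ∣_∣; _≤_) renaming (_+_ to _+ℤ_; _-_ to _-ℤ_)
open import Data.Integer.Divisibility using (_∣_)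
open import Data.Rational using (ℚ; _+_; _*_; _-_; _/_)
open import Relation.Binary.PropositionalEquality using (_≡_)

open import Data.Nat using (zero; suc; _∸_; _<_; NonZero)
import Data.Nat.Properties as ℕ
open import Data.Nat.Divisibility using (divides; ∣-refl)
import Data.Integer as ℤ
import Data.Integer.Properties as ℤ
open import Data.Integer.Tactic.RingSolver renaming (solve-∀ to ℤ-solve-∀)
open import Data.Integer.GCD using (gcd)
open import Data.Rational using (0ℚ; 1ℚ; -_; mkℚ; ↥_; fromℚᵘ)
import Data.Rational.Properties as ℚ
import Data.Rational.Unnormalised as ℚᵘ
import Data.Rational.Unnormalised.Properties as ℚᵘ
open import Data.Empty using (⊥-elim)
open import Data.Product using (_,_)
open import Relation.Nullary.Decidable using (dec⇒maybe)
open import Relation.Binary.PropositionalEquality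
  using (_≢_; refl; sym; trans; cong; cong₂; module ≡-Reasoning)
open import Tactic.RingSolver using (solve-∀)
open import Tactic.RingSolver.Core.AlmostCommutativeRing
  using (AlmostCommutativeRing; fromCommutativeRing)

open ≡-Reasoning

ℚ-ring : AlmostCommutativeRing _ _
ℚ-ring = fromCommutativeRing ℚ.+-*-commutativeRing (λ x → dec⇒maybe (0ℚ ℚ.≟ x))

fromℤ : ℤ → ℚ
fromℤ z = z / 1

fromℕ : ℕ → ℚ
fromℕ n = fromℤ (+ n)

fromℚᵘ-homo-+ : ∀ p q → fromℚᵘ (p ℚᵘ.+ q) ≡ fromℚᵘ p + fromℚᵘ q
fromℚᵘ-homo-+ p q = ℚ.toℚᵘ-injective (ℚᵘ.≃-trans (ℚ.toℚᵘ-fromℚᵘ (p ℚᵘ.+ q))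
  (ℚᵘ.≃-trans (ℚᵘ.+-cong (ℚᵘ.≃-sym (ℚ.toℚᵘ-fromℚᵘ p)) (ℚᵘ.≃-sym (ℚ.toℚᵘ-fromℚᵘ q)))
    (ℚᵘ.≃-sym (ℚ.toℚᵘ-homo-+ (fromℚᵘ p) (fromℚᵘ q)))))

fromℤ-homo-+ : ∀ x y → fromℤ (x ℤ.+ y) ≡ fromℤ x + fromℤ y
fromℤ-homo-+ x y = trans
  (ℚ.fromℚᵘ-cong {ℚᵘ.mkℚᵘ (x ℤ.+ y) 0} {ℚᵘ.mkℚᵘ x 0 ℚᵘ.+ ℚᵘ.mkℚᵘ y 0}
    (ℚᵘ.*≡* (cross x y)))
  (fromℚᵘ-homo-+ (ℚᵘ.mkℚᵘ x 0) (ℚᵘ.mkℚᵘ y 0))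
  where
  cross : ∀ x y → (x ℤ.+ y) ℤ.* + 1 ≡ (x ℤ.* + 1 ℤ.+ y ℤ.* + 1) ℤ.* + 1
  cross = ℤ-solve-∀

fromℕ-suc : ∀ i → fromℕ (suc i) ≡ 1ℚ + fromℕ i
fromℕ-suc i = fromℤ-homo-+ (+ 1) (+ i)

/≡0⇒≡0 : ∀ z d .{{_ : NonZero d}} → z / d ≡ 0ℚ → z ≡ + 0
/≡0⇒≡0 z d z/d≡0 = begin
  z                              ≡⟨ sym (ℚ.↥-/ z d) ⟩
  ↥ (z / d) ℤ.* gcd z (+ d)      ≡⟨ cong (λ q → ↥ q ℤ.* gcd z (+ d)) z/d≡0 ⟩
  + 0 ℤ.* gcd z (+ d)            ≡⟨ ℤ.*-zeroˡ (gcd z (+ d)) ⟩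
  + 0                            ∎

1+fromℕ≢0 : ∀ i → 1ℚ + fromℕ i ≢ 0ℚ
1+fromℕ≢0 i eq with /≡0⇒≡0 (+ suc i) 1 (trans (fromℕ-suc i) eq)
... | ()

inv-neg : ∀ x → inv (- x) ≡ - inv x
inv-neg (mkℚ (+ zero) _ _)   = refl
inv-neg (mkℚ (+ suc _) _ _)  = refl
inv-neg (mkℚ ℤ.-[1+ _ ] _ _) = refl

inv-inverseʳ : ∀ x → x ≢ 0ℚ → x * inv x ≡ 1ℚ
inv-inverseʳ x@(mkℚ (+ zero) _ _)   x≢0 = ⊥-elim (x≢0 (ℚ.↥p≡0⇒p≡0 x refl))
inv-inverseʳ x@(mkℚ (+ suc _) _ _)  _   = ℚ.*-inverseʳ x
inv-inverseʳ x@(mkℚ ℤ.-[1+ _ ] _ _) _   = ℚ.*-inverseʳ x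

*-≢0 : ∀ x y → x ≢ 0ℚ → y ≢ 0ℚ → x * y ≢ 0ℚ
*-≢0 x y x≢0 y≢0 xy≡0 = ℚ.1≢0 (begin
  1ℚ                          ≡⟨ sym (cong₂ _*_ (inv-inverseʳ x x≢0) (inv-inverseʳ y y≢0)) ⟩
  (x * inv x) * (y * inv y)   ≡⟨ interchange x (inv x) y (inv y) ⟩
  (x * y) * (inv x * inv y)   ≡⟨ cong (_* (inv x * inv y)) xy≡0 ⟩
  0ℚ * (inv x * inv y)        ≡⟨ ℚ.*-zeroˡ (inv x * inv y) ⟩
  0ℚ                          ∎)
  where
  interchange : ∀ a b c d → (a * b) * (c * d) ≡ (a * c) * (b * d)
  interchange = solve-∀ ℚ-ring

poch-≢0 : ∀ x → (∀ i → x + fromℕ i ≢ 0ℚ) → ∀ k → poch x k ≢ 0ℚ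
poch-≢0 x x+i≢0 zero    ()
poch-≢0 x x+i≢0 (suc k) = *-≢0 _ _ (poch-≢0 x x+i≢0 k) (x+i≢0 k)

*-inv-cross : ∀ u v x y → u * y ≡ v * x → x ≢ 0ℚ → y ≢ 0ℚ → u * inv x ≡ v * inv y
*-inv-cross u v x y uy≡vx x≢0 y≢0 = begin
  u * inv x                          ≡⟨ sym (ℚ.*-identityʳ (u * inv x)) ⟩
  u * inv x * 1ℚ                     ≡⟨ cong (u * inv x *_) (sym (inv-inverseʳ y y≢0)) ⟩
  u * inv x * (y * inv y)            ≡⟨ regroup u (inv x) y (inv y) ⟩
  (u * y) * (inv x * inv y)          ≡⟨ cong (_* (inv x * inv y)) uy≡vx ⟩
  (v * x) * (inv x * inv y)          ≡⟨ regroup′ v x (inv x) (inv y) ⟩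
  v * inv y * (x * inv x)            ≡⟨ cong (v * inv y *_) (inv-inverseʳ x x≢0) ⟩
  v * inv y * 1ℚ                     ≡⟨ ℚ.*-identityʳ (v * inv y) ⟩
  v * inv y                          ∎
  where
  regroup : ∀ a b c d → a * b * (c * d) ≡ (a * c) * (b * d)
  regroup = solve-∀ ℚ-ring
  regroup′ : ∀ a b c d → (a * b) * (c * d) ≡ a * d * (b * c)
  regroup′ = solve-∀ ℚ-ring

sumRange-cong : ∀ m {f g : ℕ → ℚ} → (∀ k → k < m → f k ≡ g k) → sumRange m f ≡ sumRange m g
sumRange-cong zero    f≗g = refl
sumRange-cong (suc m) f≗g =
  cong₂ _+_ (sumRange-cong m (λ k k<m → f≗g k (ℕ.m<n⇒m<1+n k<m))) (f≗g m ℕ.≤-refl)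

sumRange-+ : ∀ m (f g : ℕ → ℚ) → sumRange m (λ k → f k + g k) ≡ sumRange m f + sumRange m g
sumRange-+ zero    f g = refl
sumRange-+ (suc m) f g = trans (cong (_+ (f m + g m)) (sumRange-+ m f g))
  (interchange (sumRange m f) (sumRange m g) (f m) (g m))
  where
  interchange : ∀ a b c d → (a + b) + (c + d) ≡ (a + c) + (b + d)
  interchange = solve-∀ ℚ-ring

sumRange-neg : ∀ m (f : ℕ → ℚ) → sumRange m (λ k → - f k) ≡ - sumRange m f
sumRange-neg zero    f = refl
sumRange-neg (suc m) f = trans (cong (_+ (- f m)) (sumRange-neg m f))
  (sym (ℚ.neg-distrib-+ (sumRange m f) (f m)))

∸-suc : ∀ {n k} → k < n → n ∸ k ≡ suc (n ∸ suc k)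
∸-suc = ℕ.+-∸-assoc 1

sumRange-split-reverse : ∀ m (f : ℕ → ℚ) k → k ℕ.≤ m →
  sumRange m f ≡ sumRange (m ∸ k) f + sumRange k (λ i → f (m ∸ suc i))
sumRange-split-reverse m f zero    _   = sym (ℚ.+-identityʳ (sumRange m f))
sumRange-split-reverse m f (suc k) k<m = begin
  sumRange m f                          ≡⟨ sumRange-split-reverse m f k (ℕ.<⇒≤ k<m) ⟩
  sumRange (m ∸ k) f + tail             ≡⟨ cong (λ j → sumRange j f + tail) (∸-suc k<m) ⟩
  (sumRange (m ∸ suc k) f + f (m ∸ suc k)) + tail
    ≡⟨ ℚ.+-assoc (sumRange (m ∸ suc k) f) (f (m ∸ suc k)) tail ⟩
  sumRange (m ∸ suc k) f + (f (m ∸ suc k) + tail)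
    ≡⟨ cong (λ z → sumRange (m ∸ suc k) f + z) (ℚ.+-comm (f (m ∸ suc k)) tail) ⟩
  sumRange (m ∸ suc k) f + (tail + f (m ∸ suc k)) ∎
  where tail = sumRange k (λ i → f (m ∸ suc i))

sumRange-reverse : ∀ n (f : ℕ → ℚ) → sumRange (suc n) f ≡ sumRange (suc n) (λ k → f (n ∸ k))
sumRange-reverse n f = begin
  sumRange (suc n) f                               ≡⟨ sumRange-split-reverse (suc n) f (suc n) ℕ.≤-refl ⟩
  sumRange (n ∸ n) f + sumRange (suc n) (λ k → f (n ∸ k))
    ≡⟨ cong (λ j → sumRange j f + sumRange (suc n) (λ k → f (n ∸ k))) (ℕ.n∸n≡0 n) ⟩
  0ℚ + sumRange (suc n) (λ k → f (n ∸ k))          ≡⟨ ℚ.+-identityˡ _ ⟩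
  sumRange (suc n) (λ k → f (n ∸ k))               ∎

sumRange-reflect-average : ∀ n (t D : ℕ → ℚ) h →
  (∀ k → k ℕ.≤ n → t (n ∸ k) ≡ t k) → (∀ k → k ℕ.≤ n → D k + D (n ∸ k) ≡ h + h) →
  sumRange (suc n) (λ k → t k * D k) ≡ sumRange (suc n) (λ k → t k * h)
sumRange-reflect-average n t D h t-sym D-sym = halve (begin
  S + S                                                  ≡⟨ cong (λ z → S + z) S-reversed ⟩
  S + sumRange (suc n) (λ k → t k * D (n ∸ k))           ≡⟨ sym (sumRange-+ (suc n) _ _) ⟩
  sumRange (suc n) (λ k → t k * D k + t k * D (n ∸ k))
    ≡⟨ sumRange-cong (suc n) (λ k k≤n → trans (sym (ℚ.*-distribˡ-+ (t k) _ _))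
                                               (cong (t k *_) (D-sym k (ℕ.≤-pred k≤n)))) ⟩
  sumRange (suc n) (λ k → t k * (h + h))
    ≡⟨ sumRange-cong (suc n) (λ k _ → ℚ.*-distribˡ-+ (t k) h h) ⟩
  sumRange (suc n) (λ k → t k * h + t k * h)             ≡⟨ sumRange-+ (suc n) _ _ ⟩
  T + T                                                  ∎)
  where
  S = sumRange (suc n) (λ k → t k * D k)
  T = sumRange (suc n) (λ k → t k * h)
  S-reversed : S ≡ sumRange (suc n) (λ k → t k * D (n ∸ k))
  S-reversed = trans (sumRange-reverse n (λ k → t k * D k))
    (sumRange-cong (suc n) (λ k k≤n → cong (_* D (n ∸ k)) (t-sym k (ℕ.≤-pred k≤n))))
  halve : ∀ {x y} → x + x ≡ y + y → x ≡ y
  halve {x} {y} x+x≡y+y = begin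
    x              ≡⟨ double-half x ⟩
    (x + x) * ½    ≡⟨ cong (_* ½) x+x≡y+y ⟩
    (y + y) * ½    ≡⟨ sym (double-half y) ⟩
    y              ∎
    where
    ½ = + 1 / 2
    double-half : ∀ z → z ≡ (z + z) * ½
    double-half = solve-∀ ℚ-ring

sign : ℕ → ℚ
sign zero    = 1ℚ
sign (suc k) = - sign k

sign-square : ∀ k → sign k * sign k ≡ 1ℚ
sign-square zero    = refl
sign-square (suc k) = trans (neg-square (sign k)) (sign-square k)
  where
  neg-square : ∀ s → - s * - s ≡ s * s
  neg-square = solve-∀ ℚ-ring

sign-cancelˡ : ∀ k {u v} → sign k * u ≡ sign k * v → u ≡ v
sign-cancelˡ k {u} {v} su≡sv = begin
  u                        ≡⟨ sym (ℚ.*-identityˡ u) ⟩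
  1ℚ * u                   ≡⟨ cong (_* u) (sym (sign-square k)) ⟩
  sign k * sign k * u      ≡⟨ ℚ.*-assoc (sign k) (sign k) u ⟩
  sign k * (sign k * u)    ≡⟨ cong (sign k *_) su≡sv ⟩
  sign k * (sign k * v)    ≡⟨ sym (ℚ.*-assoc (sign k) (sign k) v) ⟩
  sign k * sign k * v      ≡⟨ cong (_* v) (sign-square k) ⟩
  1ℚ * v                   ≡⟨ ℚ.*-identityˡ v ⟩
  v                        ∎

record Reflected (x y : ℚ) (n : ℕ) : Set where
  constructor reflected
  field x+y+n≡1 : x + y + fromℕ n ≡ 1ℚ

Reflected-sym : ∀ {x y n} → Reflected x y n → Reflected y x n
Reflected-sym {x} {y} {n} (reflected x+y+n≡1) =
  reflected (trans (cong (_+ fromℕ n) (ℚ.+-comm y x)) x+y+n≡1)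

reflect-shift : ∀ {x y n i} → Reflected x y n → i < n →
  x + fromℕ (n ∸ suc i) ≡ - (y + fromℕ i)
reflect-shift {x} {y} {n} {i} (reflected x+y+n≡1) i<n = begin
  x + fromℕ m                                          ≡⟨ rearrange x y (fromℕ m) (fromℕ i) ⟩
  (x + y + (fromℕ m + (1ℚ + fromℕ i))) - (1ℚ + (y + fromℕ i))
    ≡⟨ cong (λ z → (x + y + z) - (1ℚ + (y + fromℕ i))) m+1+i≡n ⟩
  (x + y + fromℕ n) - (1ℚ + (y + fromℕ i))
    ≡⟨ cong (_- (1ℚ + (y + fromℕ i))) x+y+n≡1 ⟩
  1ℚ - (1ℚ + (y + fromℕ i))                            ≡⟨ cancel (y + fromℕ i) ⟩
  - (y + fromℕ i)                                      ∎
  where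
  m = n ∸ suc i
  m+1+i≡n : fromℕ m + (1ℚ + fromℕ i) ≡ fromℕ n
  m+1+i≡n = begin
    fromℕ m + (1ℚ + fromℕ i)   ≡⟨ cong (λ z → fromℕ m + z) (sym (fromℕ-suc i)) ⟩
    fromℕ m + fromℕ (suc i)    ≡⟨ sym (fromℤ-homo-+ (+ m) (+ suc i)) ⟩
    fromℕ (m ℕ.+ suc i)        ≡⟨ cong fromℕ (ℕ.m∸n+n≡m i<n) ⟩
    fromℕ n                    ∎
  rearrange : ∀ x y m i → x + m ≡ (x + y + (m + (1ℚ + i))) - (1ℚ + (y + i))
  rearrange = solve-∀ ℚ-ring
  cancel : ∀ z → 1ℚ - (1ℚ + z) ≡ - z
  cancel = solve-∀ ℚ-ring

poch-reflect : ∀ {x y n} → Reflected x y n → ∀ k → k ℕ.≤ n →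
  poch x n ≡ sign k * (poch x (n ∸ k) * poch y k)
poch-reflect {x} {y} {n} _ zero _ =
  sym (trans (ℚ.*-identityˡ _) (ℚ.*-identityʳ (poch x n)))
poch-reflect {x} {y} {n} ρ (suc k) k<n = begin
  poch x n                                             ≡⟨ poch-reflect ρ k (ℕ.<⇒≤ k<n) ⟩
  sign k * (poch x (n ∸ k) * poch y k)                 ≡⟨ cong (λ j → sign k * (poch x j * poch y k)) (∸-suc k<n) ⟩
  sign k * ((poch x m * (x + fromℕ m)) * poch y k)
    ≡⟨ cong (λ u → sign k * ((poch x m * u) * poch y k)) (reflect-shift ρ k<n) ⟩
  sign k * ((poch x m * - (y + fromℕ k)) * poch y k)   ≡⟨ move-sign (sign k) (poch x m) (y + fromℕ k) (poch y k) ⟩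
  - sign k * (poch x m * (poch y k * (y + fromℕ k)))   ∎
  where
  m = n ∸ suc k
  move-sign : ∀ s p u q → s * ((p * - u) * q) ≡ - s * (p * (q * u))
  move-sign = solve-∀ ℚ-ring

poch-reflect-full : ∀ {x y n} → Reflected x y n → poch x n ≡ sign n * poch y n
poch-reflect-full {x} {y} {n} ρ = begin
  poch x n                                ≡⟨ poch-reflect ρ n ℕ.≤-refl ⟩
  sign n * (poch x (n ∸ n) * poch y n)    ≡⟨ cong (λ j → sign n * (poch x j * poch y n)) (ℕ.n∸n≡0 n) ⟩
  sign n * (1ℚ * poch y n)                ≡⟨ cong (sign n *_) (ℚ.*-identityˡ (poch y n)) ⟩
  sign n * poch y n                       ∎

poch-cross-reflect : ∀ {x y n} → Reflected x y n → ∀ k → k ℕ.≤ n →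
  poch x (n ∸ k) * poch y k ≡ sign n * (poch x k * poch y (n ∸ k))
poch-cross-reflect {x} {y} {n} ρ k k≤n = sign-cancelˡ k (begin
  sign k * (poch x (n ∸ k) * poch y k)                ≡⟨ sym (poch-reflect ρ k k≤n) ⟩
  poch x n                                            ≡⟨ poch-reflect-full ρ ⟩
  sign n * poch y n                                   ≡⟨ cong (sign n *_) (poch-reflect (Reflected-sym ρ) k k≤n) ⟩
  sign n * (sign k * (poch y (n ∸ k) * poch x k))     ≡⟨ swap (sign n) (sign k) (poch y (n ∸ k)) (poch x k) ⟩
  sign k * (sign n * (poch x k * poch y (n ∸ k)))     ∎)
  where
  swap : ∀ s t u v → s * (t * (u * v)) ≡ t * (s * (v * u))
  swap = solve-∀ ℚ-ring

harmonic : ℚ → ℕ → ℚ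
harmonic x m = sumRange m (λ j → inv (x + fromℕ j))

harmonic-reflect : ∀ {x y n} → Reflected x y n → ∀ k → k ℕ.≤ n →
  harmonic x n ≡ harmonic x (n ∸ k) - harmonic y k
harmonic-reflect {x} {y} {n} ρ k k≤n = begin
  harmonic x n                                                       ≡⟨ sumRange-split-reverse n _ k k≤n ⟩
  harmonic x (n ∸ k) + sumRange k (λ i → inv (x + fromℕ (n ∸ suc i)))
    ≡⟨ cong (λ z → harmonic x (n ∸ k) + z) (sumRange-cong k reflected-term) ⟩
  harmonic x (n ∸ k) + sumRange k (λ i → - inv (y + fromℕ i))
    ≡⟨ cong (λ z → harmonic x (n ∸ k) + z) (sumRange-neg k (λ i → inv (y + fromℕ i))) ⟩
  harmonic x (n ∸ k) - harmonic y k                                  ∎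
  where
  reflected-term : ∀ i → i < k → inv (x + fromℕ (n ∸ suc i)) ≡ - inv (y + fromℕ i)
  reflected-term i i<k =
    trans (cong inv (reflect-shift ρ (ℕ.<-≤-trans i<k k≤n))) (inv-neg (y + fromℕ i))

harmonic-difference-reflect : ∀ {x y n} → Reflected x y n → ∀ k → k ℕ.≤ n →
  (harmonic x k - harmonic y k) + (harmonic x (n ∸ k) - harmonic y (n ∸ k))
    ≡ harmonic x n + harmonic x n
harmonic-difference-reflect {x} {y} {n} ρ k k≤n = begin
  (X - Y) + (X′ - Y′)                  ≡⟨ cong₂ (λ u v → (X - Y) + (u - v)) X′≡ Y′≡ ⟩
  (X - Y) + ((Xn + Y) - (Yn + X))      ≡⟨ rearrange X Y Xn Yn ⟩
  (Xn + Xn) - (Xn + Yn)                ≡⟨ cong (λ z → (Xn + Xn) - z) (sym Xn+Yn≡0) ⟩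
  (Xn + Xn) - 0ℚ                       ≡⟨ ℚ.+-identityʳ (Xn + Xn) ⟩
  Xn + Xn                              ∎
  where
  X  = harmonic x k
  Y  = harmonic y k
  X′ = harmonic x (n ∸ k)
  Y′ = harmonic y (n ∸ k)
  Xn = harmonic x n
  Yn = harmonic y n
  add-back : ∀ {a b c} → a ≡ b - c → b ≡ a + c
  add-back {a} {b} {c} a≡b-c = trans (sym (sub-add b c)) (cong (_+ c) (sym a≡b-c))
    where
    sub-add : ∀ b c → (b - c) + c ≡ b
    sub-add = solve-∀ ℚ-ring
  X′≡ : X′ ≡ Xn + Y
  X′≡ = add-back (harmonic-reflect ρ k k≤n)
  Y′≡ : Y′ ≡ Yn + X
  Y′≡ = add-back (harmonic-reflect (Reflected-sym ρ) k k≤n)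
  Xn+Yn≡0 : 0ℚ ≡ Xn + Yn
  Xn+Yn≡0 = add-back (trans (harmonic-reflect ρ n ℕ.≤-refl)
                            (cong (λ j → harmonic x j - Yn) (ℕ.n∸n≡0 n)))
  rearrange : ∀ X Y Xn Yn → (X - Y) + ((Xn + Y) - (Yn + X)) ≡ (Xn + Xn) - (Xn + Yn)
  rearrange = solve-∀ ℚ-ring

term : ℚ → ℚ → ℚ → ℕ → ℚ
term c a b k =
  poch c k * poch a k * poch a k * poch a k * inv (poch 1ℚ k * poch b k * poch b k * poch b k)

term-reflect : ∀ {c a b n} → Reflected c 1ℚ n → Reflected a b n → (∀ i → b + fromℕ i ≢ 0ℚ) →
  ∀ k → k ℕ.≤ n → term c a b (n ∸ k) ≡ term c a b k
term-reflect {c} {a} {b} {n} ρc ρa b+i≢0 k k≤n =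
  *-inv-cross (P (n ∸ k)) (P k) (Q (n ∸ k)) (Q k) cross (Q≢0 (n ∸ k)) (Q≢0 k)
  where
  P Q : ℕ → ℚ
  P j = poch c j * poch a j * poch a j * poch a j
  Q j = poch 1ℚ j * poch b j * poch b j * poch b j
  Q≢0 : ∀ j → Q j ≢ 0ℚ
  Q≢0 j = *-≢0 _ _ (*-≢0 _ _ (*-≢0 _ _ (poch-≢0 1ℚ 1+fromℕ≢0 j) b≢0) b≢0) b≢0
    where b≢0 = poch-≢0 b b+i≢0 j
  regroup : ∀ p q u v → (p * q * q * q) * (u * v * v * v) ≡ (p * u) * (q * v) * (q * v) * (q * v)
  regroup = solve-∀ ℚ-ring
  drop-signs : ∀ s u v → s * s ≡ 1ℚ → (s * u) * (s * v) * (s * v) * (s * v) ≡ u * v * v * v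
  drop-signs s u v s²≡1 = begin
    (s * u) * (s * v) * (s * v) * (s * v)      ≡⟨ collect s u v ⟩
    (s * s) * (s * s) * (u * v * v * v)        ≡⟨ cong (λ z → z * z * (u * v * v * v)) s²≡1 ⟩
    1ℚ * 1ℚ * (u * v * v * v)                  ≡⟨ ℚ.*-identityˡ (u * v * v * v) ⟩
    u * v * v * v                              ∎
    where
    collect : ∀ s u v → (s * u) * (s * v) * (s * v) * (s * v) ≡ (s * s) * (s * s) * (u * v * v * v)
    collect = solve-∀ ℚ-ring
  cross : P (n ∸ k) * Q k ≡ P k * Q (n ∸ k)
  cross = begin
    P (n ∸ k) * Q k
      ≡⟨ regroup (poch c (n ∸ k)) (poch a (n ∸ k)) (poch 1ℚ k) (poch b k) ⟩
    (poch c (n ∸ k) * poch 1ℚ k) * (poch a (n ∸ k) * poch b k)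
      * (poch a (n ∸ k) * poch b k) * (poch a (n ∸ k) * poch b k)
      ≡⟨ cong₂ (λ u v → u * v * v * v) (poch-cross-reflect ρc k k≤n) (poch-cross-reflect ρa k k≤n) ⟩
    (sign n * (poch c k * poch 1ℚ (n ∸ k))) * (sign n * (poch a k * poch b (n ∸ k)))
      * (sign n * (poch a k * poch b (n ∸ k))) * (sign n * (poch a k * poch b (n ∸ k)))
      ≡⟨ drop-signs (sign n) _ _ (sign-square n) ⟩
    (poch c k * poch 1ℚ (n ∸ k)) * (poch a k * poch b (n ∸ k))
      * (poch a k * poch b (n ∸ k)) * (poch a k * poch b (n ∸ k))
      ≡⟨ sym (regroup (poch c k) (poch a k) (poch 1ℚ (n ∸ k)) (poch b (n ∸ k))) ⟩
    P k * Q (n ∸ k) ∎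

thirds : ∀ r → r / 3 + (r ℤ.+ r) / 3 ≡ fromℤ r
thirds r = sym (trans
  (ℚ.fromℚᵘ-cong {ℚᵘ.mkℚᵘ r 0} {ℚᵘ.mkℚᵘ r 2 ℚᵘ.+ ℚᵘ.mkℚᵘ (r ℤ.+ r) 2} (ℚᵘ.*≡* (cross r)))
  (fromℚᵘ-homo-+ (ℚᵘ.mkℚᵘ r 2) (ℚᵘ.mkℚᵘ (r ℤ.+ r) 2)))
  where
  cross : ∀ r → r ℤ.* + 9 ≡ (r ℤ.* + 3 ℤ.+ (r ℤ.+ r) ℤ.* + 3) ℤ.* + 1
  cross = ℤ-solve-∀

-- Were (2r)/3 + i = 0, then r = 3 (r + i), so 3 would divide r.
two-thirds+fromℕ≢0 : ∀ r → Coprime ∣ r ∣ 3 → ∀ i → (r ℤ.+ r) / 3 + fromℕ i ≢ 0ℚ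
two-thirds+fromℕ≢0 r coprime i eq = 3≢1 (coprime (divides ∣ r ℤ.+ + i ∣ ∣r∣≡∣r+i∣*3 , ∣-refl))
  where
  3≢1 : 3 ≢ 1
  3≢1 ()
  X = r ℤ.+ r ℤ.+ + 3 ℤ.* + i
  X≡0 : X ≡ + 0
  X≡0 = /≡0⇒≡0 X 3 (trans
    (ℚ.fromℚᵘ-cong {ℚᵘ.mkℚᵘ X 2} {ℚᵘ.mkℚᵘ (r ℤ.+ r) 2 ℚᵘ.+ ℚᵘ.mkℚᵘ (+ i) 0} (ℚᵘ.*≡* (cross r (+ i))))
    (trans (fromℚᵘ-homo-+ (ℚᵘ.mkℚᵘ (r ℤ.+ r) 2) (ℚᵘ.mkℚᵘ (+ i) 0)) eq))
    where
    cross : ∀ r i → (r ℤ.+ r ℤ.+ + 3 ℤ.* i) ℤ.* + 3 ≡ ((r ℤ.+ r) ℤ.* + 1 ℤ.+ i ℤ.* + 3) ℤ.* + 3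
    cross = ℤ-solve-∀
  r≡3[r+i] : r ≡ + 3 ℤ.* (r ℤ.+ + i)
  r≡3[r+i] = begin
    r                       ≡⟨ sym (ℤ.+-identityʳ r) ⟩
    r ℤ.+ + 0               ≡⟨ cong (λ z → r ℤ.+ z) (sym X≡0) ⟩
    r ℤ.+ X                 ≡⟨ expand r (+ i) ⟩
    + 3 ℤ.* (r ℤ.+ + i)     ∎
    where
    expand : ∀ r i → r ℤ.+ (r ℤ.+ r ℤ.+ + 3 ℤ.* i) ≡ + 3 ℤ.* (r ℤ.+ i)
    expand = ℤ-solve-∀
  ∣r∣≡∣r+i∣*3 : ∣ r ∣ ≡ ∣ r ℤ.+ + i ∣ ℕ.* 3
  ∣r∣≡∣r+i∣*3 = trans (cong ∣_∣ r≡3[r+i]) (trans (ℤ.abs-* (+ 3) (r ℤ.+ + i)) (ℕ.*-comm 3 ∣ r ℤ.+ + i ∣))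

lemma2p6 : (r : ℤ) → r ≤ + 1 → Coprime ∣ r ∣ 3 →
  (p : ℕ) → Prime p → p > 3 → + 3 ∣ (+ p +ℤ r) → + 3 -ℤ r ≤ + p →
  let n = ∣ + 1 -ℤ r ∣
      a = r / 3
      b = (r +ℤ r) / 3
      c = (r -ℤ + 1) / 1
      t = λ (k : ℕ) → poch c k * poch a k * poch a k * poch a k * inv (poch (+ 1 / 1) k * poch b k * poch b k * poch b k)
      H = λ (x : ℚ) (m : ℕ) → sumRange m (λ j → inv (x + (+ j / 1)))
  in sumRange (ℕ.suc n) (λ k → t k * (H b k - H a k))
     ≡ sumRange (ℕ.suc n) (λ k → t k * H b n)
lemma2p6 r r≤1 coprime _ _ _ _ _ =
  sumRange-reflect-average n (term c a b) (λ k → harmonic b k - harmonic a k) (harmonic b n)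
    (term-reflect c1-reflected ab-reflected (two-thirds+fromℕ≢0 r coprime))
    (harmonic-difference-reflect (Reflected-sym ab-reflected))
  where
  n = ∣ + 1 -ℤ r ∣
  a = r / 3
  b = (r +ℤ r) / 3
  c = (r -ℤ + 1) / 1
  r+n≡1 : fromℤ r + fromℕ n ≡ 1ℚ
  r+n≡1 = begin
    fromℤ r + fromℕ n       ≡⟨ sym (fromℤ-homo-+ r (+ n)) ⟩
    fromℤ (r +ℤ + n)        ≡⟨ cong (λ m → fromℤ (r +ℤ m)) (ℤ.0≤i⇒+∣i∣≡i (ℤ.i≤j⇒0≤j-i r≤1)) ⟩
    fromℤ (r +ℤ (+ 1 -ℤ r)) ≡⟨ cong fromℤ (r+[1-r]≡1 r) ⟩
    1ℚ                      ∎
    where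
    r+[1-r]≡1 : ∀ r → r +ℤ (+ 1 -ℤ r) ≡ + 1
    r+[1-r]≡1 = ℤ-solve-∀
  ab-reflected : Reflected a b n
  ab-reflected = reflected (trans (cong (_+ fromℕ n) (thirds r)) r+n≡1)
  c1-reflected : Reflected c 1ℚ n
  c1-reflected = reflected (trans (cong (_+ fromℕ n) c+1≡r) r+n≡1)
    where
    c+1≡r : c + 1ℚ ≡ fromℤ r
    c+1≡r = trans (sym (fromℤ-homo-+ (r -ℤ + 1) (+ 1))) (cong fromℤ ([r-1]+1≡r r))
      where
      [r-1]+1≡r : ∀ r → (r -ℤ + 1) +ℤ + 1 ≡ r
      [r-1]+1≡r = ℤ-solve-∀
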